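{- The parity family $\mathrm{PAR}=(\mathrm{PAR}_n)_{n\in\mathbb{N}}$ belongs to $\mathrm{IS}^0{:}B(5n-2)$; that is, there is $h:\mathbb{N}\to\mathbb{N}$ and $m\in\mathbb{N}$ with $h(n)\le 5n-2$ for all $n\ge m$, such that for every $n\in\mathbb{N}$ some instruction sequence using no auxiliary registers computes $\mathrm{PAR}_n$ and has length at most $h(n)$.
   Context: Booleans are $\mathrm{F}$ and $\mathrm{T}$. An instruction sequence is a finite sequence $u_1;u_2;\dots;u_k$ of primitive instructions; its length is $k$. Basic instructions are: $\mathrm{in}{:}i.\mathrm{get}$ ($i\ge1$), $\mathrm{out}.\mathrm{set}{:}b$ ($b\in\{\mathrm{F},\mathrm{T}\}$), $\mathrm{aux}{:}i.\mathrm{get}$, $\mathrm{aux}{:}i.\mathrm{set}{:}b$, $\mathrm{aux}{:}i.\mathrm{com}$ ($i\ge1$). Each names a Boolean register ($\mathrm{in}{:}i$ input, $\mathrm{out}$ output, $\mathrm{aux}{:}i$ auxiliary) and a command: $\mathrm{get}$ leaves the register unchanged and replies its content; $\mathrm{set}{:}b$ sets the content to $b$ and replies $b$; $\mathrm{com}$ complements the content and replies the new content. Primitive instructions: for each basic instruction $a$, plain $a$, positive test ${+}a$, negative test ${ - }a$; forward jumps $\#l$ ($l\in\mathbb{N}$); termination $!$. Execution starts at $u_1$. ${+}a$ executes $a$ and proceeds with the next instruction if the reply is $\mathrm{T}$, otherwise skips the next instruction and proceeds with the one after; ${ - }a$ likewise with replies reversed; plain $a$ executes $a$ and proceeds with the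 next instruction; $\#l$ proceeds with the $l$th next instruction; $!$ terminates. If $l=0$ or there is no instruction to proceed with, inaction occurs (no termination). $X$ computes $f:\{\mathrm{F},\mathrm{T}\}^n\to\{\mathrm{F},\mathrm{T}\}$ if there is $k\in\mathbb{N}$ (at least every auxiliary index used in $X$) such that for all $b_1,\dots,b_n$: starting with $\mathrm{in}{:}i$ containing $b_i$, $\mathrm{out}$ containing $\mathrm{F}$, and $\mathrm{aux}{:}1,\dots,\mathrm{aux}{:}k$ containing $\mathrm{F}$, execution terminates with $\mathrm{out}$ containing $f(b_1,\dots,b_n)$. $\mathrm{IS}^k$ denotes the set of instruction sequences in which no instruction of the form $\mathrm{aux}{:}i.c$, ${+}\mathrm{aux}{:}i.c$, ${ - }\mathrm{aux}{:}i.c$ with $i>k$ occurs; so $\mathrm{IS}^0$ uses no auxiliary registers. For a set $\mathcal{I}$ of instruction sequences and $f:\mathbb{N}\to\mathbb{N}$, $\mathcal{I}{:}B(f(n))$ is the class of Boolean function families $(f_n)_{n\in\mathbb{N}}$ ($f_n$ $n$-ary) for which there exists $h:\mathbb{N}\to\mathbb{N}$ with $h(n)\le f(n)$ for all sufficiently large $n$ such that for all $n$ there is $X\in\mathcal{I}$ computing $f_n$ with length at most $h(n)$. $\mathrm{PAR}_n(b_1,\dots,b_n)=\mathrm{T}$ iff the number of $\mathrm{T}$'s among $b_1,\dots,b_n$ is odd. -}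

module Defs where

open import Data.Bool using (Bool; true; false; not; _xor_)
open import Data.Nat using (ℕ; zero; suc; _≤_; _<_; _*_; _∸_; _≟_)
open import Data.Unit using (⊤)
open import Relation.Nullary using (yes; no)
open import Data.List using (List; []; _∷_; drop; length; foldr)
open import Data.List.Relation.Unary.All using (All)
open import Data.Maybe using (Maybe; just; nothing)
open import Data.Vec using (Vec; lookup)
open import Data.Fin using (fromℕ<)
open import Data.Product using (Σ; ∃; _×_; _,_)
open import Relation.Binary.PropositionalEquality using (_≡_)

-- Booleans: F = false, T = true.

-- Registers.  Indices are 1-based in the paper; here  inR i  denotes in:(i+1)
-- and  auxR i  denotes aux:(i+1), so every ℕ is a legal index.
data Reg : Set where
  inR  : ℕ → Reg
  out  : Reg
  auxR : ℕ → Reg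

data Cmd : Set where
  get : Cmd
  set : Bool → Cmd
  com : Cmd

data Basic : Set where
  inGet  : ℕ → Basic
  outSet : Bool → Basic
  auxCmd : ℕ → Cmd → Basic

data Instr : Set where
  plain : Basic → Instr
  ptest : Basic → Instr
  ntest : Basic → Instr
  jump  : ℕ → Instr
  halt  : Instr

InstrSeq : Set
InstrSeq = List Instr

record State : Set where
  constructor st
  field
    inp  : ℕ → Bool
    outv : Bool
    aux  : ℕ → Bool
open State public

update : (ℕ → Bool) → ℕ → Bool → ℕ → Bool
update f i b j with i ≟ j
... | yes _ = b
... | no  _ = f j

doBasic : Basic → State → State × Bool
doBasic (inGet i)        s = s , inp s i
doBasic (outSet b)       s = st (inp s) b (aux s) , b
doBasic (auxCmd i get)   s = s , aux s i
doBasic (auxCmd i (set b)) s = st (inp s) (outv s) (update (aux s) i b) , b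
doBasic (auxCmd i com)   s =
  st (inp s) (outv s) (update (aux s) i (not (aux s i))) , not (aux s i)

-- The argument list is the remaining suffix of the
-- instruction sequence starting at the current instruction.
-- Result  just s  = execution terminated (by !) in state s;
-- nothing = inaction (jump #0 or running off the end) or fuel exhausted.
run : ℕ → InstrSeq → State → Maybe State
run zero    _ _ = nothing
run (suc f) [] s = nothing
run (suc f) (plain a ∷ xs) s with doBasic a s
... | s' , _ = run f xs s'
run (suc f) (ptest a ∷ xs) s with doBasic a s
... | s' , true  = run f xs s'
... | s' , false = run f (drop 1 xs) s'
run (suc f) (ntest a ∷ xs) s with doBasic a s
... | s' , false = run f xs s'
... | s' , true  = run f (drop 1 xs) s'
run (suc f) (jump zero ∷ xs) s = nothing
run (suc f) (jump (suc l) ∷ xs) s = run f (drop l xs) s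
run (suc f) (halt ∷ xs) s = just s

TerminatesWith : InstrSeq → State → Bool → Set
TerminatesWith X s b = ∃ λ fuel → ∃ λ s' → run fuel X s ≡ just s' × outv s' ≡ b

BasicAuxBelow : ℕ → Basic → Set
BasicAuxBelow k (auxCmd i _) = suc i ≤ k
BasicAuxBelow k _            = ⊤

InstrAuxBelow : ℕ → Instr → Set
InstrAuxBelow k (plain a) = BasicAuxBelow k a
InstrAuxBelow k (ptest a) = BasicAuxBelow k a
InstrAuxBelow k (ntest a) = BasicAuxBelow k a
InstrAuxBelow k _         = ⊤

InIS : ℕ → InstrSeq → Set
InIS k X = All (InstrAuxBelow k) X

-- Admissible initial state for inputs bs and k auxiliary registers:
-- in:i contains b_i (1 ≤ i ≤ n), out contains F, aux:1..aux:k contain F.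
-- All other registers may hold arbitrary contents.
Initial : {n : ℕ} → ℕ → Vec Bool n → State → Set
Initial {n} k bs s =
  ((i : ℕ) (i<n : i < n) → inp s i ≡ lookup bs (fromℕ< i<n)) ×
  (outv s ≡ false) ×
  ((i : ℕ) → suc i ≤ k → aux s i ≡ false)

Computes : {n : ℕ} → InstrSeq → (Vec Bool n → Bool) → Set
Computes {n} X f =
  ∃ λ k → InIS k X ×
    ((bs : Vec Bool n) (s : State) → Initial k bs s → TerminatesWith X s (f bs))

PAR : (n : ℕ) → Vec Bool n → Bool
PAR n bs = Data.Vec.foldr _ _xor_ false bs

InISB : ℕ → ((n : ℕ) → Vec Bool n → Bool) → (ℕ → ℕ) → Set
InISB k fam g =
  Σ (ℕ → ℕ) λ h →
    (∃ λ m → (n : ℕ) → m ≤ n → h n ≤ g n) ×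
    ((n : ℕ) → ∃ λ X → InIS k X × Computes X (fam n) × length X ≤ h n)

module Submission where

-- Parity is computed by a single left-to-right scan that stores the parity
-- of the inputs read so far in the program counter instead of a register.
--
-- The scan is a chain of blocks, one per input.  Every block has two entry
-- points, three instructions apart: the "even" entry is taken when an even
-- number of T's has been read, the "odd" entry otherwise.  A block reads its
-- input with one test and jumps to the entry of the next block matching the
-- updated parity; each block has length 5.  The last block has length 6 and,
-- from either entry, sets out to T exactly when the final parity is odd.
-- The first input needs only the even entry, so two instructions suffice
-- for it, giving total length 2 + 5(n-2) + 6 = 5n-2 for n ≥ 2.

open import Defs
open import Data.Nat using (ℕ; zero; suc; _+_; _*_; _∸_; _≤_; _<_; s≤s; z≤n)
open import Data.Nat.Properties using (≤-refl; ≤-reflexive)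
open import Data.Nat.Tactic.RingSolver using (solve-∀)
open import Data.Fin using (fromℕ<)
open import Data.Bool using (Bool; true; false; _xor_; if_then_else_)
open import Data.Bool.Properties using (not-involutive)
open import Data.List using ([]; _∷_; _++_; drop; length)
open import Data.List.Relation.Unary.All using ([]; _∷_)
open import Data.List.Relation.Unary.All.Properties using (++⁺)
open import Data.Vec using (Vec; lookup) renaming ([] to []ᵥ; _∷_ to _∷ᵥ_)
open import Data.Product using (∃; _,_)
open import Data.Unit using (tt)
open import Data.Maybe using (just)
open import Relation.Binary.PropositionalEquality using (_≡_; refl; sym; trans; cong; cong₂)

parityFrom : (ℕ → Bool) → ℕ → ℕ → Bool
parityFrom v j zero    = false
parityFrom v j (suc n) = v j xor parityFrom v (suc j) n

parityFrom-shift : ∀ v j n → parityFrom v (suc j) n ≡ parityFrom (λ k → v (suc k)) j n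
parityFrom-shift v j zero    = refl
parityFrom-shift v j (suc n) = cong (v (suc j) xor_) (parityFrom-shift v (suc j) n)

PAR-parityFrom : ∀ n (bs : Vec Bool n) (v : ℕ → Bool) →
                 ((k : ℕ) (k<n : k < n) → v k ≡ lookup bs (fromℕ< k<n)) →
                 PAR n bs ≡ parityFrom v 0 n
PAR-parityFrom zero    []ᵥ        v agree = refl
PAR-parityFrom (suc n) (b ∷ᵥ bs) v agree =
  cong₂ _xor_ (sym (agree 0 (s≤s z≤n)))
    (trans (PAR-parityFrom n bs (λ k → v (suc k)) (λ k k<n → agree (suc k) (s≤s k<n)))
           (sym (parityFrom-shift v 0 n)))

ptest-in : ∀ j s {f xs c} → inp s j ≡ c →
           run (suc f) (ptest (inGet j) ∷ xs) s ≡ run f (if c then xs else drop 1 xs) s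
ptest-in j s eq with inp s j | eq
... | true  | refl = refl
... | false | refl = refl

ntest-in : ∀ j s {f xs c} → inp s j ≡ c →
           run (suc f) (ntest (inGet j) ∷ xs) s ≡ run f (if c then drop 1 xs else xs) s
ntest-in j s eq with inp s j | eq
... | true  | refl = refl
... | false | refl = refl

-- Block for in:(j+1).  Even entry at offset 0, odd entry at offset 3; the
-- jumps lead to the even (offset 5) or odd (offset 8) entry of the next block.
block : ℕ → InstrSeq
block j = ptest (inGet j) ∷ jump 7 ∷ jump 3 ∷ ntest (inGet j) ∷ jump 4 ∷ []

lastBlock : ℕ → InstrSeq
lastBlock j = ptest (inGet j) ∷ plain (outSet true) ∷ halt
            ∷ ntest (inGet j) ∷ plain (outSet true) ∷ halt ∷ []

chain : ℕ → ℕ → InstrSeq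
chain j zero    = lastBlock j
chain j (suc r) = block j ++ chain (suc j) r

entry : Bool → InstrSeq → InstrSeq
entry false X = X
entry true  X = drop 3 X

chain-correct : ∀ b j r i a →
  ∃ λ f → run f (entry b (chain j r)) (st i false a) ≡ just (st i (b xor parityFrom i j (suc r)) a)
chain-correct b j r i a with i j in eq
chain-correct false j zero    i a | true  = 3 , ptest-in j (st i false a) eq
chain-correct false j zero    i a | false = 2 , ptest-in j (st i false a) eq
chain-correct true  j zero    i a | true  = 2 , ntest-in j (st i false a) eq
chain-correct true  j zero    i a | false = 3 , ntest-in j (st i false a) eq
chain-correct false j (suc r) i a | true  with chain-correct true (suc j) r i a
... | f , e = suc (suc f) , trans (ptest-in j (st i false a) eq) e
chain-correct false j (suc r) i a | false with chain-correct false (suc j) r i a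
... | f , e = suc (suc f) , trans (ptest-in j (st i false a) eq) e
chain-correct true  j (suc r) i a | true  with chain-correct false (suc j) r i a
-- odd parity meets another T: the two complementations of the parity cancel
... | f , e = suc f , trans (ntest-in j (st i false a) eq)
                             (trans e (cong (λ c → just (st i c a)) (sym (not-involutive _))))
chain-correct true  j (suc r) i a | false with chain-correct true (suc j) r i a
... | f , e = suc (suc f) , trans (ntest-in j (st i false a) eq) e

length-chain : ∀ j r → length (chain j r) ≡ 5 * r + 6
length-chain j zero    = refl
length-chain j (suc r) = trans (cong (5 +_) (length-chain (suc j) r)) (five-more r)
  where
  five-more : ∀ r → 5 + (5 * r + 6) ≡ 5 * suc r + 6
  five-more = solve-∀

chain-aux-free : ∀ j r → InIS 0 (chain j r)
chain-aux-free j zero    = tt ∷ tt ∷ tt ∷ tt ∷ tt ∷ tt ∷ []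
chain-aux-free j (suc r) = ++⁺ (tt ∷ tt ∷ tt ∷ tt ∷ tt ∷ []) (chain-aux-free (suc j) r)

-- The program for PAR n.  For n ≥ 2 the first input is read by a cut-down
-- block that jumps to the even (offset 2) or odd (offset 5) entry of the chain.
parity : ℕ → InstrSeq
parity zero          = halt ∷ []
parity (suc zero)    = ptest (inGet 0) ∷ plain (outSet true) ∷ halt ∷ []
parity (suc (suc r)) = ptest (inGet 0) ∷ jump 4 ∷ chain 1 r

parity-correct : ∀ n i a → ∃ λ f → run f (parity n) (st i false a) ≡ just (st i (parityFrom i 0 n) a)
parity-correct zero          i a = 1 , refl
parity-correct (suc n)       i a with i 0 in eq
parity-correct (suc zero)    i a | true  = 3 , ptest-in 0 (st i false a) eq
parity-correct (suc zero)    i a | false = 2 , ptest-in 0 (st i false a) eq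
parity-correct (suc (suc r)) i a | true  with chain-correct true 1 r i a
... | f , e = suc (suc f) , trans (ptest-in 0 (st i false a) eq) e
parity-correct (suc (suc r)) i a | false with chain-correct false 1 r i a
... | f , e = suc f , trans (ptest-in 0 (st i false a) eq) e

parity-aux-free : ∀ n → InIS 0 (parity n)
parity-aux-free zero          = tt ∷ []
parity-aux-free (suc zero)    = tt ∷ tt ∷ tt ∷ []
parity-aux-free (suc (suc r)) = tt ∷ tt ∷ chain-aux-free 1 r

parity-length : ∀ n → 1 ≤ n → length (parity n) ≤ 5 * n ∸ 2
parity-length (suc zero)    _ = ≤-refl
parity-length (suc (suc r)) _ =
  ≤-reflexive (trans (cong (2 +_) (length-chain 1 r)) (sym (cong (_∸ 2) (total r))))
  where
  total : ∀ r → 5 * suc (suc r) ≡ 2 + (2 + (5 * r + 6))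
  total = solve-∀

parity-computes : ∀ n → Computes (parity n) (PAR n)
parity-computes n = 0 , parity-aux-free n , λ where
  bs (st i .false a) (agree , refl , _) →
    let (f , e) = parity-correct n i a
    in f , st i (parityFrom i 0 n) a , e , sym (PAR-parityFrom n bs i agree)

theorem1 : InISB 0 PAR (λ n → 5 * n ∸ 2)
theorem1 =
  (λ n → length (parity n)) , (1 , parity-length) ,
  λ n → parity n , parity-aux-free n , parity-computes n , ≤-refl
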